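{- Consider any execution of the procedure Explore described below on a finite unfolding $\mathfrak U$, and let $b,b_1,b_2,b_3,b_4$ be nodes of its call graph with $b\triangleright_l b_1\triangleright^* b_3$ and $b\triangleright_r b_2\triangleright^* b_4$. Writing $b_3=(C_3,D_3,A_3,e_3)$ and $b_4=(C_4,D_4,A_4,e_4)$, we have $C_3\neq C_4$.
   Context: $\mathfrak U=(E,<,\#,h)$ is a finite labelled event structure (causality $<$ a strict partial order, conflict $\#$ symmetric irreflexive and inherited along $<$) with a minimal event $\bot$ (the unfolding of a system under an independence relation); a configuration is a finite causally closed conflict-free set of events; $[e]=\{e'\le e\}$, $\lceil e\rceil=\{e'<e\}$; $e\#_ie'$ if $e\#e'$ and both $\lceil e\rceil\cup[e']$ and $[e]\cup\lceil e'\rceil$ are configurations. $\mathrm{ex}(C)=\{e\notin C:\lceil e\rceil\subseteq C\}$, $\mathrm{en}(C)=\{e\in\mathrm{ex}(C):C\cup\{e\}\text{ a configuration}\}$. For $U\subseteq E$, $\#_U(e)=\{e'\in U:e\#_ie'\}$, $Q_{C,D,U}=C\cup D\cup\bigcup_{e\in C\cup D,\,e'\in\#_U(e)}[e']$. An alternative to $D$ after $C$ (w.r.t. $U$) is a configuration $J\subseteq U$ with $C\cup J$ a configuration and, for each $e\in D$, some $e'\in C\cup J$ in $\#_U(e)$; $\mathrm{Alt}(X,Y)$ is the set of all alternatives to $Y$ after $X$ w.r.t. the current $U$. Algorithm: global $U$ (initially $\{\bot\}$), $G$ (initially $\emptyset$); start with $\mathrm{Explore}(\{\bot\},\emptyset,\emptyset)$.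 $\mathrm{Explore}(C,D,A)$: (1) add $\mathrm{ex}(C)$ to $U$; (2) if $\mathrm{en}(C)\cap U=\emptyset$, return; (3) if $A=\emptyset$ choose any $e\in\mathrm{en}(C)\cap U$, else any $e\in A\cap\mathrm{en}(C)\cap U$; (4) call $\mathrm{Explore}(C\cup\{e\},D,A\setminus\{e\})$; (5) if some $J\in\mathrm{Alt}(C,D\cup\{e\})$ exists, call $\mathrm{Explore}(C,D\cup\{e\},J\setminus C)$; (6) move $\{e\}\setminus Q_{C,D,U}$ from $U$ to $G$ and, for each $\hat e\in\#_U(e)$, move $[\hat e]\setminus Q_{C,D,U}$ from $U$ to $G$. Call graph: nodes are tuples $(C,D,A,e)$ such that $\mathrm{Explore}(C,D,A)$ was called and $e$ is the event chosen in step (3) (or $\bot$ if the call returned at step (2)); $b\triangleright_l b'$ (resp. $\triangleright_r$) if the call of $b$ issues the call of $b'$ at step (4) (resp. (5)); $\triangleright=\triangleright_l\cup\triangleright_r$ and $\triangleright^*$ its reflexive-transitive closure; root $(\{\bot\},\emptyset,\emptyset,\bot)$. -}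

module Defs where

open import Level using (0ℓ)
open import Data.Nat using (ℕ)
open import Data.Fin using (Fin)
open import Data.Empty using (⊥)
open import Data.Sum using (_⊎_)
open import Data.Product using (_×_; Σ; ∃; ∃₂)
open import Relation.Nullary using (¬_)
open import Relation.Binary.PropositionalEquality using (_≡_)
open import Relation.Binary.Construct.Closure.ReflexiveTransitive using (Star)
open import Relation.Unary using (Pred; _∪_; _∩_; _⊆_; _≐_; ∅; ｛_｝; _∖_)

-- Finite labelled event structures with a least event ⊥
-- (events are Fin n; finiteness of the unfolding is built in)

record EventStructure : Set₁ where
  field
    n       : ℕ
    Label   : Set
    _≺_     : Fin n → Fin n → Set
    _#_     : Fin n → Fin n → Set
    h       : Fin n → Label
    ≺-irrefl : ∀ e → ¬ (e ≺ e)
    ≺-trans  : ∀ {e e′ e″} → e ≺ e′ → e′ ≺ e″ → e ≺ e″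
    #-sym    : ∀ {e e′} → e # e′ → e′ # e
    #-irrefl : ∀ e → ¬ (e # e)
    #-inh    : ∀ {e e′ e″} → e # e′ → e′ ≺ e″ → e # e″
    ⊥ₑ       : Fin n
    ⊥-least  : ∀ e → ⊥ₑ ≡ e ⊎ ⊥ₑ ≺ e

-- The procedure Explore, as a relational (nondeterministic) big-step
-- semantics, and its call graph.

module Explore (𝔘 : EventStructure) where
  open EventStructure 𝔘

  Ev : Set
  Ev = Fin n

  ESet : Set₁
  ESet = Pred Ev 0ℓ

  _≼_ : Ev → Ev → Set
  e ≼ e′ = e ≡ e′ ⊎ e ≺ e′

  [_] : Ev → ESet
  [ e ] = λ e′ → e′ ≼ e

  ⌈_⌉ : Ev → ESet
  ⌈ e ⌉ = λ e′ → e′ ≺ e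

  -- configuration (finiteness is automatic: there are finitely many events)
  IsConfig : ESet → Set
  IsConfig C = (∀ e e′ → C e → e′ ≺ e → C e′)
             × (∀ e e′ → C e → C e′ → ¬ (e # e′))

  _#ᵢ_ : Ev → Ev → Set
  e #ᵢ e′ = e # e′ × IsConfig (⌈ e ⌉ ∪ [ e′ ]) × IsConfig ([ e ] ∪ ⌈ e′ ⌉)

  ex : ESet → ESet
  ex C e = ¬ C e × (⌈ e ⌉ ⊆ C)

  en : ESet → ESet
  en C e = ex C e × IsConfig (C ∪ ｛ e ｝)

  #[_] : ESet → Ev → ESet
  #[ U ] e e′ = U e′ × e #ᵢ e′

  Q : ESet → ESet → ESet → ESet
  Q C D U x = (C ∪ D) x
            ⊎ ∃₂ (λ e e′ → (C ∪ D) e × #[ U ] e e′ × [ e′ ] x)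

  Alt : ESet → ESet → ESet → ESet → Set
  Alt U C D J = J ⊆ U × IsConfig J × IsConfig (C ∪ J)
              × (∀ e → D e → ∃ λ e′ → (C ∪ J) e′ × #[ U ] e e′)

  -- step (1): U ∪ ex(C)
  addEx : ESet → ESet → ESet
  addEx U C = U ∪ ex C

  -- step (3): e is a legal choice (w.r.t. the current U, C, A)
  Choice : ESet → ESet → ESet → Ev → Set
  Choice U C A e = (en C ∩ U) e × ((∀ x → ¬ A x) ⊎ A e)

  -- step (6): the set moved from U to G (computed w.r.t. the U current
  -- at the start of step (6)): ({e} ∪ ⋃_{ê ∈ #_U(e)} [ê]) ∖ Q_{C,D,U}
  Moved : ESet → ESet → ESet → Ev → ESet
  Moved U C D e = (｛ e ｝ ∪ (λ x → ∃ λ ê → #[ U ] e ê × [ ê ] x)) ∖ Q C D U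

  moveU : ESet → ESet → ESet → Ev → ESet
  moveU U C D e = U ∖ Moved U C D e

  moveG : ESet → ESet → ESet → ESet → Ev → ESet
  moveG U G C D e = G ∪ Moved U C D e

  -- Exec U G C D A U′ G′ : the call Explore(C,D,A), started with global
  -- state (U,G), terminates with global state (U′,G′).  A derivation is
  -- the tree of recursive calls.
  data Exec : ESet → ESet → ESet → ESet → ESet → ESet → ESet → Set₁ where
    -- step (2): en(C) ∩ U = ∅, return
    ret : ∀ {U G C D A} →
          (∀ e → ¬ (en C ∩ addEx U C) e) →
          Exec U G C D A (addEx U C) G
    -- steps (3),(4); no alternative at step (5); step (6)
    callₗ : ∀ {U G C D A U₂ G₂} (e : Ev) →
            Choice (addEx U C) C A e →
            Exec (addEx U C) G (C ∪ ｛ e ｝) D (A ∖ ｛ e ｝) U₂ G₂ →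
            (∀ J → ¬ Alt U₂ C (D ∪ ｛ e ｝) J) →
            Exec U G C D A (moveU U₂ C D e) (moveG U₂ G₂ C D e)
    -- steps (3),(4); alternative J found, right call at step (5); step (6)
    callᵣ : ∀ {U G C D A U₂ G₂ U₃ G₃} (e : Ev) →
            Choice (addEx U C) C A e →
            Exec (addEx U C) G (C ∪ ｛ e ｝) D (A ∖ ｛ e ｝) U₂ G₂ →
            (J : ESet) → Alt U₂ C (D ∪ ｛ e ｝) J →
            Exec U₂ G₂ C (D ∪ ｛ e ｝) (J ∖ C) U₃ G₃ →
            Exec U G C D A (moveU U₃ C D e) (moveG U₃ G₃ C D e)

  record Node : Set₁ where
    constructor node
    field
      Cₙ Dₙ Aₙ : ESet
      eₙ       : Ev
  open Node public

  _≈ₙ_ : Node → Node → Set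
  b ≈ₙ b′ = Cₙ b ≐ Cₙ b′ × Dₙ b ≐ Dₙ b′ × Aₙ b ≐ Aₙ b′ × eₙ b ≡ eₙ b′

  nodeOf : ∀ {U G C D A U′ G′} → Exec U G C D A U′ G′ → Node
  nodeOf {C = C} {D} {A} (ret _)               = node C D A ⊥ₑ
  nodeOf {C = C} {D} {A} (callₗ e _ _ _)       = node C D A e
  nodeOf {C = C} {D} {A} (callᵣ e _ _ _ _ _)   = node C D A e

  data Dir : Set where
    l r : Dir

  -- Edge d τ b b′ : somewhere in the call tree τ, a call with tuple b
  -- issues at step (4) (d = l) / step (5) (d = r) a call with tuple b′
  data Edge : Dir → ∀ {U G C D A U′ G′} → Exec U G C D A U′ G′ →
              Node → Node → Set₁ where
    hereₗ  : ∀ {U G C D A U₂ G₂} {e ch} {x : Exec (addEx U C) G (C ∪ ｛ e ｝) D (A ∖ ｛ e ｝) U₂ G₂} {na} →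
             Edge l (callₗ {U} {G} {C} {D} {A} e ch x na) (node C D A e) (nodeOf x)
    hereₗ′ : ∀ {U G C D A U₂ G₂ U₃ G₃} {e ch} {x : Exec (addEx U C) G (C ∪ ｛ e ｝) D (A ∖ ｛ e ｝) U₂ G₂}
               {J al} {y : Exec U₂ G₂ C (D ∪ ｛ e ｝) (J ∖ C) U₃ G₃} →
             Edge l (callᵣ {U} {G} {C} {D} {A} e ch x J al y) (node C D A e) (nodeOf x)
    hereᵣ  : ∀ {U G C D A U₂ G₂ U₃ G₃} {e ch} {x : Exec (addEx U C) G (C ∪ ｛ e ｝) D (A ∖ ｛ e ｝) U₂ G₂}
               {J al} {y : Exec U₂ G₂ C (D ∪ ｛ e ｝) (J ∖ C) U₃ G₃} →
             Edge r (callᵣ {U} {G} {C} {D} {A} e ch x J al y) (node C D A e) (nodeOf y)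
    inₗ    : ∀ {d U G C D A U₂ G₂} {e ch} {x : Exec (addEx U C) G (C ∪ ｛ e ｝) D (A ∖ ｛ e ｝) U₂ G₂} {na b b′} →
             Edge d x b b′ → Edge d (callₗ {U} {G} {C} {D} {A} e ch x na) b b′
    inₗ′   : ∀ {d U G C D A U₂ G₂ U₃ G₃} {e ch} {x : Exec (addEx U C) G (C ∪ ｛ e ｝) D (A ∖ ｛ e ｝) U₂ G₂}
               {J al} {y : Exec U₂ G₂ C (D ∪ ｛ e ｝) (J ∖ C) U₃ G₃} {b b′} →
             Edge d x b b′ → Edge d (callᵣ {U} {G} {C} {D} {A} e ch x J al y) b b′
    inᵣ    : ∀ {d U G C D A U₂ G₂ U₃ G₃} {e ch} {x : Exec (addEx U C) G (C ∪ ｛ e ｝) D (A ∖ ｛ e ｝) U₂ G₂}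
               {J al} {y : Exec U₂ G₂ C (D ∪ ｛ e ｝) (J ∖ C) U₃ G₃} {b b′} →
             Edge d y b b′ → Edge d (callᵣ {U} {G} {C} {D} {A} e ch x J al y) b b′

  Execution : ESet → ESet → Set₁
  Execution U′ G′ = Exec ｛ ⊥ₑ ｝ ∅ ｛ ⊥ₑ ｝ ∅ ∅ U′ G′

  -- the call graph of an execution τ, on tuples (up to equality of tuples)
  module CallGraph {U′ G′ : ESet} (τ : Execution U′ G′) where

    _▷[_]_ : Node → Dir → Node → Set₁
    b ▷[ d ] b′ = Σ Node λ b₀ → Σ Node λ b₀′ →
                  b ≈ₙ b₀ × b′ ≈ₙ b₀′ × Edge d τ b₀ b₀′

    _▷ₗ_ : Node → Node → Set₁
    b ▷ₗ b′ = b ▷[ l ] b′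

    _▷ᵣ_ : Node → Node → Set₁
    b ▷ᵣ b′ = b ▷[ r ] b′

    _▷_ : Node → Node → Set₁
    b ▷ b′ = b ▷ₗ b′ ⊎ b ▷ᵣ b′

    _▷*_ : Node → Node → Set₁
    _▷*_ = Star _▷_

module Submission where

-- Every call Explore(C,D,A) satisfies an invariant: C ∪ A is conflict-free and every
-- event of D is in conflict with an event of C ∪ A.  It holds at the root, survives a
-- left call (C ∪ {e} is a configuration, and e ∈ A unless A = ∅) and is re-established
-- by a right call from the alternative J, which becomes C ∪ A.  Along call-graph edges
-- C and D only grow, so the event e chosen at b lies in C₃ (via b ▷ₗ b₁) and in D₄ (via
-- b ▷ᵣ b₂); C₃ = C₄ would put e into both C₄ and D₄, against the invariant at b₄.

open import Defs
open import Function using (_∘_; id)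
open import Data.Empty using (⊥-elim)
open import Data.Sum using (_⊎_; inj₁; inj₂) renaming (map to ⊎-map)
open import Data.Product using (_×_; _,_; proj₁; proj₂; ∃)
open import Relation.Unary.Properties using (≐-sym)
open import Relation.Nullary using (¬_)
open import Relation.Nullary.Negation using (¬¬-map)
open import Relation.Unary using (_≐_; _⊆_; _∪_; ｛_｝; _∖_; ∅)
open import Relation.Binary.PropositionalEquality using (_≡_; refl; sym; subst)
open import Relation.Binary.Construct.Closure.ReflexiveTransitive using (ε; _◅_; fold)

module ExploreProperties (𝔘 : EventStructure) where
  open EventStructure 𝔘
  open Explore 𝔘

  ConflictFree : ESet → Set
  ConflictFree S = ∀ {x y} → S x → S y → ¬ (x # y)

  ConflictFree-⊆ : ∀ {S T} → S ⊆ T → ConflictFree T → ConflictFree S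
  ConflictFree-⊆ S⊆T T-cf x∈S y∈S = T-cf (S⊆T x∈S) (S⊆T y∈S)

  IsConfig⇒ConflictFree : ∀ {S} → IsConfig S → ConflictFree S
  IsConfig⇒ConflictFree (_ , cf) = cf _ _

  record Consistent (C D A : ESet) : Set where
    field
      conflict-free : ConflictFree (C ∪ A)
      -- ¬ ¬: after a right call a witness in C ∪ J lies in C ∪ (J ∖ C) only up to
      -- double negation, C not being decidable.
      disabled      : ∀ {d} → D d → ∃ λ e′ → ¬ ¬ (C ∪ A) e′ × d # e′

    disjoint : ∀ {x} → C x → ¬ D x
    disjoint x∈C x∈D with disabled x∈D
    ... | e′ , ¬¬e′∈C∪A , x#e′ = ¬¬e′∈C∪A λ e′∈C∪A → conflict-free (inj₁ x∈C) e′∈C∪A x#e′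

  open Consistent

  Consistent-resp-≐ : ∀ {C C′ D D′ A A′} → C ≐ C′ → D ≐ D′ → A ≐ A′ →
                      Consistent C D A → Consistent C′ D′ A′
  Consistent-resp-≐ (C⊆C′ , C′⊆C) (_ , D′⊆D) (A⊆A′ , A′⊆A) κ = record
    { conflict-free = ConflictFree-⊆ (⊎-map C′⊆C A′⊆A) (conflict-free κ)
    ; disabled      = λ d∈D′ → let e′ , ¬¬e′∈ , d#e′ = disabled κ (D′⊆D d∈D′)
                               in e′ , ¬¬-map (⊎-map C⊆C′ A⊆A′) ¬¬e′∈ , d#e′
    }

  ¬¬-split : ∀ {P Q : ESet} {x} → Q x → ¬ ¬ (P ∪ (Q ∖ P)) x
  ¬¬-split q ¬split = ¬split (inj₂ (q , ¬split ∘ inj₁))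

  consistent-root : Consistent ｛ ⊥ₑ ｝ ∅ ∅
  consistent-root = record
    { conflict-free = λ { (inj₁ refl) (inj₁ refl) → #-irrefl ⊥ₑ }
    ; disabled      = λ ()
    }

  Choice-consistent : ∀ {U C D A e} → Choice U C A e →
                      Consistent C D A → Consistent (C ∪ ｛ e ｝) D (A ∖ ｛ e ｝)
  Choice-consistent {C = C} {A = A} {e} (((_ , C∪e-config) , _) , A-status) κ = record
    { conflict-free = conflict-free′ A-status
    ; disabled      = λ d∈D → let e′ , ¬¬e′∈ , d#e′ = disabled κ d∈D
                              in e′ , (λ ¬e′∈ → ¬¬e′∈ (¬¬-step ¬e′∈)) , d#e′
    }
    where
      conflict-free′ : (∀ x → ¬ A x) ⊎ A e → ConflictFree ((C ∪ ｛ e ｝) ∪ (A ∖ ｛ e ｝))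
      conflict-free′ (inj₁ A≡∅) = ConflictFree-⊆ ⊆C∪e (IsConfig⇒ConflictFree C∪e-config)
        where
          ⊆C∪e : (C ∪ ｛ e ｝) ∪ (A ∖ ｛ e ｝) ⊆ C ∪ ｛ e ｝
          ⊆C∪e (inj₁ x∈C∪e)     = x∈C∪e
          ⊆C∪e (inj₂ (x∈A , _)) = ⊥-elim (A≡∅ _ x∈A)
      conflict-free′ (inj₂ e∈A) = ConflictFree-⊆ ⊆C∪A (conflict-free κ)
        where
          ⊆C∪A : (C ∪ ｛ e ｝) ∪ (A ∖ ｛ e ｝) ⊆ C ∪ A
          ⊆C∪A (inj₁ (inj₁ x∈C)) = inj₁ x∈C
          ⊆C∪A (inj₁ (inj₂ refl)) = inj₂ e∈A
          ⊆C∪A (inj₂ (x∈A , _))  = inj₂ x∈A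
      ¬¬-step : ∀ {x} → ¬ ((C ∪ ｛ e ｝) ∪ (A ∖ ｛ e ｝)) x → ¬ (C ∪ A) x
      ¬¬-step ¬x∈ (inj₁ x∈C) = ¬x∈ (inj₁ (inj₁ x∈C))
      ¬¬-step ¬x∈ (inj₂ x∈A) = ¬¬-split {｛ e ｝} {A} x∈A (¬x∈ ∘ ⊎-map inj₂ id)

  Alt-consistent : ∀ {U C D J} → Alt U C D J → Consistent C D (J ∖ C)
  Alt-consistent {C = C} {J = J} (_ , _ , C∪J-config , alternative) = record
    { conflict-free = ConflictFree-⊆ (⊎-map id proj₁)
                                     (IsConfig⇒ConflictFree C∪J-config)
    ; disabled      = λ d∈D → let e′ , e′∈C∪J , _ , d#ᵢe′ = alternative _ d∈D
                              in e′ , ¬¬-split-C∪J e′∈C∪J , proj₁ d#ᵢe′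
    }
    where
      ¬¬-split-C∪J : ∀ {x} → (C ∪ J) x → ¬ ¬ (C ∪ (J ∖ C)) x
      ¬¬-split-C∪J (inj₁ x∈C) ¬x∈ = ¬x∈ (inj₁ x∈C)
      ¬¬-split-C∪J (inj₂ x∈J)     = ¬¬-split {C} {J} x∈J

  Consistentₙ : Node → Set
  Consistentₙ b = Consistent (Cₙ b) (Dₙ b) (Aₙ b)

  data Step : Dir → Node → Node → Set₁ where
    left  : ∀ {C D A e e′} U → Choice U C A e →
            Step l (node C D A e) (node (C ∪ ｛ e ｝) D (A ∖ ｛ e ｝) e′)
    right : ∀ {C D A e J e′} U → Alt U C (D ∪ ｛ e ｝) J →
            Step r (node C D A e) (node C (D ∪ ｛ e ｝) (J ∖ C) e′)

  Step-C-⊆ : ∀ {d a c} → Step d a c → Cₙ a ⊆ Cₙ c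
  Step-C-⊆ (left _ _)  = inj₁
  Step-C-⊆ (right _ _) = id

  Step-D-⊆ : ∀ {d a c} → Step d a c → Dₙ a ⊆ Dₙ c
  Step-D-⊆ (left _ _)  = id
  Step-D-⊆ (right _ _) = inj₁

  Stepₗ-chosen∈C : ∀ {a c} → Step l a c → Cₙ c (eₙ a)
  Stepₗ-chosen∈C (left _ _) = inj₂ refl

  Stepᵣ-chosen∈D : ∀ {a c} → Step r a c → Dₙ c (eₙ a)
  Stepᵣ-chosen∈D (right _ _) = inj₂ refl

  Step-consistent : ∀ {d a c} → Step d a c → Consistentₙ a → Consistentₙ c
  Step-consistent (left U choice) = Choice-consistent {U} choice
  Step-consistent (right U alt)   = λ _ → Alt-consistent {U} alt

  nodeOf-args : ∀ {U G C D A U′ G′} (x : Exec U G C D A U′ G′) →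
                nodeOf x ≡ node C D A (eₙ (nodeOf x))
  nodeOf-args (ret _)               = refl
  nodeOf-args (callₗ _ _ _ _)       = refl
  nodeOf-args (callᵣ _ _ _ _ _ _)   = refl

  Edge⇒Step : ∀ {d U G C D A U′ G′ a c} {x : Exec U G C D A U′ G′} →
              Edge d x a c → Step d a c
  Edge⇒Step (hereₗ {U = U} {ch = ch} {x = x}) =
    subst (Step l _) (sym (nodeOf-args x)) (left (addEx U _) ch)
  Edge⇒Step (hereₗ′ {U = U} {ch = ch} {x = x}) =
    subst (Step l _) (sym (nodeOf-args x)) (left (addEx U _) ch)
  Edge⇒Step (hereᵣ {U₂ = U₂} {al = al} {y = y}) =
    subst (Step r _) (sym (nodeOf-args y)) (right U₂ al)
  Edge⇒Step (inₗ E)  = Edge⇒Step E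
  Edge⇒Step (inₗ′ E) = Edge⇒Step E
  Edge⇒Step (inᵣ E)  = Edge⇒Step E

  Edge-consistent : ∀ {d U G C D A U′ G′ a c} {x : Exec U G C D A U′ G′} →
                    Consistent C D A → Edge d x a c → Consistentₙ c
  Edge-consistent κ E@hereₗ  = Step-consistent (Edge⇒Step E) κ
  Edge-consistent κ E@hereₗ′ = Step-consistent (Edge⇒Step E) κ
  Edge-consistent κ E@hereᵣ  = Step-consistent (Edge⇒Step E) κ
  Edge-consistent κ (inₗ {U = U} {ch = ch} E) =
    Edge-consistent (Choice-consistent {addEx U _} ch κ) E
  Edge-consistent κ (inₗ′ {U = U} {ch = ch} E) =
    Edge-consistent (Choice-consistent {addEx U _} ch κ) E
  Edge-consistent _ (inᵣ {U₂ = U₂} {al = al} E) =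
    Edge-consistent (Alt-consistent {U₂} al) E

  module CallGraphProperties {U′ G′ : ESet} (τ : Execution U′ G′) where
    open CallGraph τ

    ▷[]-C-⊆ : ∀ {d b b′} → b ▷[ d ] b′ → Cₙ b ⊆ Cₙ b′
    ▷[]-C-⊆ (_ , _ , b≈a , b′≈c , E) =
      proj₂ (proj₁ b′≈c) ∘ Step-C-⊆ (Edge⇒Step E) ∘ proj₁ (proj₁ b≈a)

    ▷[]-D-⊆ : ∀ {d b b′} → b ▷[ d ] b′ → Dₙ b ⊆ Dₙ b′
    ▷[]-D-⊆ (_ , _ , b≈a , b′≈c , E) =
      proj₂ (proj₁ (proj₂ b′≈c)) ∘ Step-D-⊆ (Edge⇒Step E) ∘ proj₁ (proj₁ (proj₂ b≈a))

    ▷[]-consistent : ∀ {d b b′} → b ▷[ d ] b′ → Consistentₙ b′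
    ▷[]-consistent (_ , _ , _ , (C≐ , D≐ , A≐ , _) , E) =
      Consistent-resp-≐ (≐-sym C≐) (≐-sym D≐) (≐-sym A≐) (Edge-consistent consistent-root E)

    ▷*-C-⊆ : ∀ {b b′} → b ▷* b′ → Cₙ b ⊆ Cₙ b′
    ▷*-C-⊆ = fold (λ b b′ → Cₙ b ⊆ Cₙ b′) (λ { (inj₁ s) ⊆′ → ⊆′ ∘ ▷[]-C-⊆ s
                                                ; (inj₂ s) ⊆′ → ⊆′ ∘ ▷[]-C-⊆ s }) id

    ▷*-D-⊆ : ∀ {b b′} → b ▷* b′ → Dₙ b ⊆ Dₙ b′
    ▷*-D-⊆ = fold (λ b b′ → Dₙ b ⊆ Dₙ b′) (λ { (inj₁ s) ⊆′ → ⊆′ ∘ ▷[]-D-⊆ s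
                                                ; (inj₂ s) ⊆′ → ⊆′ ∘ ▷[]-D-⊆ s }) id

    ▷-▷*-consistent : ∀ {d b b′ b″} → b ▷[ d ] b′ → b′ ▷* b″ → Consistentₙ b″
    ▷-▷*-consistent s ε                = ▷[]-consistent s
    ▷-▷*-consistent _ (inj₁ s ◅ steps) = ▷-▷*-consistent s steps
    ▷-▷*-consistent _ (inj₂ s ◅ steps) = ▷-▷*-consistent s steps

    ▷ₗ-chosen∈C : ∀ {b b′} → b ▷ₗ b′ → Cₙ b′ (eₙ b)
    ▷ₗ-chosen∈C (_ , c , (_ , _ , _ , eb≡ea) , b′≈c , E) =
      proj₂ (proj₁ b′≈c) (subst (Cₙ c) (sym eb≡ea) (Stepₗ-chosen∈C (Edge⇒Step E)))

    ▷ᵣ-chosen∈D : ∀ {b b′} → b ▷ᵣ b′ → Dₙ b′ (eₙ b)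
    ▷ᵣ-chosen∈D (_ , c , (_ , _ , _ , eb≡ea) , b′≈c , E) =
      proj₂ (proj₁ (proj₂ b′≈c)) (subst (Dₙ c) (sym eb≡ea) (Stepᵣ-chosen∈D (Edge⇒Step E)))

lemma10 : (𝔘 : EventStructure) →
    let open Explore 𝔘 in
    ∀ {U′ G′} (τ : Execution U′ G′) →
    let open CallGraph τ in
    ∀ (b b₁ b₂ b₃ b₄ : Node) →
    b ▷ₗ b₁ → b₁ ▷* b₃ → b ▷ᵣ b₂ → b₂ ▷* b₄ →
    ¬ (Cₙ b₃ ≐ Cₙ b₄)
lemma10 𝔘 τ _ _ _ _ _ b▷ₗb₁ b₁▷*b₃ b▷ᵣb₂ b₂▷*b₄ (C₃⊆C₄ , _) =
  Consistent.disjoint (▷-▷*-consistent b▷ᵣb₂ b₂▷*b₄)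
    (C₃⊆C₄ (▷*-C-⊆ b₁▷*b₃ (▷ₗ-chosen∈C b▷ₗb₁)))
    (▷*-D-⊆ b₂▷*b₄ (▷ᵣ-chosen∈D b▷ᵣb₂))
  where
    open ExploreProperties 𝔘
    open CallGraphProperties τ
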